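{- For every $r$-strongly-degenerate graph $H$ on $h$ vertices and every positive integer $n$, $R(H, K_{n,n}) \leq h^2 n^r$.
   Context: A graph $H$ is $r$-strongly-degenerate if there is an ordering $v_1,\dots,v_h$ of its vertices such that for every $i$, either $|N(v_i) \cap \{v_1,\dots,v_{i-1}\}| \leq r-1$ or $d_H(v_i) \leq r$ (the degree of $v_i$ in $H$). For graphs $H$ and $F$, $R(H,F)$ is the smallest $N$ such that for every graph $G$ on $N$ vertices, either $G$ contains a copy of $H$ or its complement $\overline{G}$ contains a copy of $F$. $K_{n,n}$ is the complete bipartite graph with both sides of size $n$. -}

module Defs where

open import Data.Nat using (ℕ; suc; _+_; _≤_)
open import Data.Fin using (Fin; _≟_; _<?_; splitAt)
open import Data.Bool using (Bool; true; false; not; _∧_; _xor_)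
open import Data.Bool.Properties using (∧-zeroʳ)
open import Data.List using (List; filterᵇ; length; allFin)
open import Data.Sum using (_⊎_; inj₁; inj₂)
open import Data.Product using (Σ; _×_; ∃)
open import Relation.Binary.PropositionalEquality using (_≡_; refl; sym; cong₂)
open import Relation.Nullary using (yes; no)
open import Relation.Nullary.Decidable using (⌊_⌋)
open import Function.Definitions using (Injective)
open import Function.Bundles using (_↔_; Inverse)

record Graph (n : ℕ) : Set where
  field
    adj    : Fin n → Fin n → Bool
    adj-sym    : ∀ u v → adj u v ≡ adj v u
    adj-irrefl : ∀ v → adj v v ≡ false
open Graph public

distinct : ∀ {n} → Fin n → Fin n → Bool
distinct u v = not ⌊ u ≟ v ⌋

distinct-sym : ∀ {n} (u v : Fin n) → distinct u v ≡ distinct v u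
distinct-sym u v with u ≟ v | v ≟ u
... | yes _ | yes _ = refl
... | no _  | no _  = refl
... | yes p | no q  with q (sym p)
... | ()
distinct-sym u v | no p | yes q with p (sym q)
... | ()

distinct-irrefl : ∀ {n} (v : Fin n) → distinct v v ≡ false
distinct-irrefl v with v ≟ v
... | yes _ = refl
... | no p with p refl
... | ()

complement : ∀ {n} → Graph n → Graph n
complement G = record
  { adj = λ u v → not (adj G u v) ∧ distinct u v
  ; adj-sym = λ u v → cong₂ (λ a b → not a ∧ b) (adj-sym G u v) (distinct-sym u v)
  ; adj-irrefl = λ v → ∧-zeroʳ' (not (adj G v v)) (distinct-irrefl v)
  }
  where
  ∧-zeroʳ' : ∀ a {b} → b ≡ false → (a ∧ b) ≡ false
  ∧-zeroʳ' a refl = ∧-zeroʳ a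

_⊆G_ : ∀ {h N} → Graph h → Graph N → Set
_⊆G_ {h} {N} H G =
  Σ (Fin h → Fin N) λ f →
    Injective _≡_ _≡_ f × (∀ u v → adj H u v ≡ true → adj G (f u) (f v) ≡ true)

isLeft : ∀ n → Fin (n + n) → Bool
isLeft n v with splitAt n v
... | inj₁ _ = true
... | inj₂ _ = false

Knn : (n : ℕ) → Graph (n + n)
Knn n = record
  { adj = λ u v → isLeft n u xor isLeft n v
  ; adj-sym = λ u v → xor-comm (isLeft n u) (isLeft n v)
  ; adj-irrefl = λ v → xor-self (isLeft n v)
  }
  where
  xor-comm : ∀ a b → (a xor b) ≡ (b xor a)
  xor-comm false false = refl
  xor-comm false true  = refl
  xor-comm true  false = refl
  xor-comm true  true  = refl
  xor-self : ∀ a → (a xor a) ≡ false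
  xor-self false = refl
  xor-self true  = refl

degree : ∀ {h} → Graph h → Fin h → ℕ
degree H v = length (filterᵇ (adj H v) (allFin _))

-- Number of neighbours of v_i = σ i among the earlier vertices
-- v_1, ..., v_{i-1} of the ordering σ (σ i is the i-th vertex).
backDegree : ∀ {h} → Graph h → (Fin h ↔ Fin h) → Fin h → ℕ
backDegree H σ i =
  length (filterᵇ (λ j → ⌊ j <? i ⌋ ∧ adj H (Inverse.to σ i) (Inverse.to σ j)) (allFin _))

-- r-strongly-degenerate: there is an ordering v_1..v_h of the vertices such
-- that each v_i has at most r-1 earlier neighbours (written: count + 1 ≤ r)
-- or has degree at most r.
StronglyDegenerate : ∀ {h} → ℕ → Graph h → Set
StronglyDegenerate {h} r H =
  Σ (Fin h ↔ Fin h) λ σ → ∀ i →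
    (suc (backDegree H σ i) ≤ r) ⊎ (degree H (Inverse.to σ i) ≤ r)

-- Ramsey property: every graph G on N vertices contains H or its
-- complement contains F.  R(H,F) ≤ N  iff  this holds for N (R being the least such N).
RamseyProp : ∀ {h f} → Graph h → Graph f → ℕ → Set
RamseyProp H F N = (G : Graph N) → (H ⊆G G) ⊎ (F ⊆G complement G)

module Submission where

-- Embed the vertices of H greedily in a strongly degenerate order, keeping for
-- every vertex q not yet embedded a set of candidates: the vertices of G adjacent
-- to the images of all embedded neighbours of q.  If k neighbours of q are
-- embedded, q keeps at least t (r − k) candidates, where t 0 = h and
-- t (d + 1) = n·t d + n.  Before embedding the next vertex v, call x sparse for a
-- later neighbour q of v if fewer than t (r − k − 1) candidates of q are adjacent
-- to x.  If some q has n sparse vertices X, deleting X and its neighbours from the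
-- candidates of q leaves n vertices with no edge to X, a K_{n,n} in the complement.
-- Otherwise each later neighbour has fewer than n sparse vertices, and strong
-- degeneracy of v (either fewer than r earlier neighbours, so t (r − k) ≥ t 1, or
-- degree at most r, so at most r − k later neighbours) leaves a candidate for v
-- that is unused and sparse for nobody.  Finally t r ≤ h² n^r once h, n ≥ 2.

open import Defs
open import Data.Nat using (ℕ; zero; suc; _+_; _*_; _^_; _∸_; _≤_; _<_; _>_; z≤n; s≤s; s≤s⁻¹; >-nonZero)
open import Data.Nat.Properties
open import Data.Fin using (Fin; zero; suc; toℕ; fromℕ<; lift; inject≤; splitAt; _↑ˡ_; _↑ʳ_)
import Data.Fin.Properties as Finₚ
open import Data.Fin.Properties using (any?)
open import Data.Bool using (Bool; true; false; not; _∧_; _∨_; if_then_else_)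
import Data.Bool.Properties as Boolₚ
open import Data.Bool.Properties using (∧-conicalˡ; ∧-conicalʳ; ∨-conicalˡ; ∨-conicalʳ; not-injective)
open import Data.Empty using (⊥-elim)
open import Data.List using (filterᵇ; length; tabulate)
open import Data.Vec.Functional using (updateAt)
open import Data.Vec.Functional.Properties using (updateAt-updates; updateAt-minimal)
open import Data.Product using (Σ; ∃; _×_; _,_; proj₁; proj₂)
open import Data.Sum using (_⊎_; inj₁; inj₂; [_,_]; map₁)
open import Function using (_∘_; id; case_of_)
open import Function.Bundles using (_↔_; Inverse; Injection)
open import Function.Properties.Inverse using (↔⇒↣; ↔-sym)
open import Function.Definitions using (Injective)
open import Relation.Binary.PropositionalEquality hiding ([_])
open import Relation.Nullary using (¬_; ¬?; Dec; yes; no; _×-dec_)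
open import Relation.Nullary.Decidable using (⌊_⌋; ⌊⌋-map′)

⌊⌋≡true⇒ : ∀ {A : Set} (a? : Dec A) → ⌊ a? ⌋ ≡ true → A
⌊⌋≡true⇒ (yes a) _ = a

⌊⌋≡false⇒ : ∀ {A : Set} (a? : Dec A) → ⌊ a? ⌋ ≡ false → ¬ A
⌊⌋≡false⇒ (no ¬a) _ = ¬a

⌊⌋-true : ∀ {A : Set} (a? : Dec A) → A → ⌊ a? ⌋ ≡ true
⌊⌋-true (yes _) _ = refl
⌊⌋-true (no ¬a) a = ⊥-elim (¬a a)

⌊⌋-false : ∀ {A : Set} (a? : Dec A) → ¬ A → ⌊ a? ⌋ ≡ false
⌊⌋-false (yes a) ¬a = ⊥-elim (¬a a)
⌊⌋-false (no _)  _  = refl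

true∧≡false⇒ : ∀ {c d} → c ≡ true → c ∧ d ≡ false → d ≡ false
true∧≡false⇒ refl c∧d = c∧d

∸≡suc∸suc : ∀ {a r} → suc a ≤ r → r ∸ a ≡ suc (r ∸ suc a)
∸≡suc∸suc {zero}  {suc r} _          = refl
∸≡suc∸suc {suc a} {suc r} (s≤s a<r) = ∸≡suc∸suc a<r

implicationᵇ⁻ : ∀ {a b} → not a ∨ b ≡ true → a ≡ true → b ≡ true
implicationᵇ⁻ {true} a⇒b refl = a⇒b

implicationᵇ⁺ : ∀ {a b} → (a ≡ true → b ≡ true) → not a ∨ b ≡ true
implicationᵇ⁺ {true}  a⇒b = a⇒b refl
implicationᵇ⁺ {false} _   = refl

anyᶠ : ∀ {N} → (Fin N → Bool) → Bool
anyᶠ {zero}  P = false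
anyᶠ {suc N} P = P zero ∨ anyᶠ (P ∘ suc)

allᶠ : ∀ {N} → (Fin N → Bool) → Bool
allᶠ {zero}  P = true
allᶠ {suc N} P = P zero ∧ allᶠ (P ∘ suc)

anyᶠ≡false⇒ : ∀ {N} (P : Fin N → Bool) → anyᶠ P ≡ false → ∀ x → P x ≡ false
anyᶠ≡false⇒ P e zero    = ∨-conicalˡ _ _ e
anyᶠ≡false⇒ P e (suc x) = anyᶠ≡false⇒ (P ∘ suc) (∨-conicalʳ _ _ e) x

allᶠ≡true⇒ : ∀ {N} (P : Fin N → Bool) → allᶠ P ≡ true → ∀ x → P x ≡ true
allᶠ≡true⇒ P e zero    = ∧-conicalˡ _ _ e
allᶠ≡true⇒ P e (suc x) = allᶠ≡true⇒ (P ∘ suc) (∧-conicalʳ _ _ e) x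

allᶠ≡true⁺ : ∀ {N} (P : Fin N → Bool) → (∀ x → P x ≡ true) → allᶠ P ≡ true
allᶠ≡true⁺ {zero}  P all = refl
allᶠ≡true⁺ {suc N} P all = cong₂ _∧_ (all zero) (allᶠ≡true⁺ (P ∘ suc) (all ∘ suc))

_⊆ᵇ_ : ∀ {N} → (Fin N → Bool) → (Fin N → Bool) → Set
P ⊆ᵇ Q = ∀ x → P x ≡ true → Q x ≡ true

count : ∀ {N} → (Fin N → Bool) → ℕ
count {zero}  P = 0
count {suc N} P = if P zero then suc (count (P ∘ suc)) else count (P ∘ suc)

count-cong : ∀ {N} {P Q : Fin N → Bool} → (∀ x → P x ≡ Q x) → count P ≡ count Q
count-cong {zero}  P≗Q = refl
count-cong {suc N} P≗Q rewrite P≗Q zero = cong (λ c → if _ then suc c else c) (count-cong (P≗Q ∘ suc))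

count-mono : ∀ {N} {P Q : Fin N → Bool} → P ⊆ᵇ Q → count P ≤ count Q
count-mono {zero} P⊆Q = z≤n
count-mono {suc N} {P} {Q} P⊆Q with P zero in p | Q zero in q
... | true  | true  = s≤s (count-mono (P⊆Q ∘ suc))
... | false | true  = m≤n⇒m≤1+n (count-mono (P⊆Q ∘ suc))
... | false | false = count-mono (P⊆Q ∘ suc)
... | true  | false with () ← trans (sym q) (P⊆Q zero p)

count-false : ∀ {N} → count {N} (λ _ → false) ≡ 0
count-false {zero}  = refl
count-false {suc N} = count-false {N}

count-true : ∀ {N} → count {N} (λ _ → true) ≡ N
count-true {zero}  = refl
count-true {suc N} = cong suc (count-true {N})

count≤ : ∀ {N} (P : Fin N → Bool) → count P ≤ N
count≤ {N} P = subst (count P ≤_) (count-true {N}) (count-mono {N} {P} {λ _ → true} (λ _ _ → refl))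

count<-missing : ∀ {N} (P : Fin N → Bool) x → P x ≡ false → count P < N
count<-missing {suc N} P zero    e rewrite e = s≤s (count≤ (P ∘ suc))
count<-missing {suc N} P (suc x) e with P zero
... | true  = s≤s (count<-missing (P ∘ suc) x e)
... | false = m≤n⇒m≤1+n (count<-missing (P ∘ suc) x e)

count-insert : ∀ {N} {P Q : Fin N → Bool} x → P ⊆ᵇ Q → P x ≡ false → Q x ≡ true →
  suc (count P) ≤ count Q
count-insert {suc N} {P} {Q} zero    P⊆Q p q rewrite p | q = s≤s (count-mono (P⊆Q ∘ suc))
count-insert {suc N} {P} {Q} (suc x) P⊆Q p q with P zero in p₀ | Q zero in q₀
... | true  | true  = s≤s (count-insert x (P⊆Q ∘ suc) p q)
... | false | true  = m≤n⇒m≤1+n (count-insert x (P⊆Q ∘ suc) p q)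
... | false | false = count-insert x (P⊆Q ∘ suc) p q
... | true  | false with () ← trans (sym q₀) (P⊆Q zero p₀)

count-∨ : ∀ {N} (P Q : Fin N → Bool) → count (λ x → P x ∨ Q x) ≤ count P + count Q
count-∨ {zero} P Q = z≤n
count-∨ {suc N} P Q with P zero | Q zero
... | true  | true  = s≤s (≤-trans (count-∨ (P ∘ suc) (Q ∘ suc)) (+-monoʳ-≤ (count (P ∘ suc)) (n≤1+n _)))
... | true  | false = s≤s (count-∨ (P ∘ suc) (Q ∘ suc))
... | false | true  = ≤-trans (s≤s (count-∨ (P ∘ suc) (Q ∘ suc))) (≤-reflexive (sym (+-suc _ _)))
... | false | false = count-∨ (P ∘ suc) (Q ∘ suc)

count-disjoint : ∀ {N} {P Q R : Fin N → Bool} → (∀ x → P x ≡ true → Q x ≡ false) →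
  P ⊆ᵇ R → Q ⊆ᵇ R → count P + count Q ≤ count R
count-disjoint {zero} _ _ _ = z≤n
count-disjoint {suc N} {P} {Q} {R} disj P⊆R Q⊆R with P zero in p | Q zero in q | R zero in r
... | true  | true  | _     with () ← trans (sym q) (disj zero p)
... | true  | false | true  = s≤s rest
  where rest = count-disjoint (disj ∘ suc) (P⊆R ∘ suc) (Q⊆R ∘ suc)
... | false | true  | true  = ≤-trans (≤-reflexive (+-suc _ _)) (s≤s rest)
  where rest = count-disjoint (disj ∘ suc) (P⊆R ∘ suc) (Q⊆R ∘ suc)
... | false | false | true  = m≤n⇒m≤1+n (count-disjoint (disj ∘ suc) (P⊆R ∘ suc) (Q⊆R ∘ suc))
... | false | false | false = count-disjoint (disj ∘ suc) (P⊆R ∘ suc) (Q⊆R ∘ suc)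
... | true  | false | false with () ← trans (sym r) (P⊆R zero p)
... | false | true  | false with () ← trans (sym r) (Q⊆R zero q)

count-≟ : ∀ {N} (x : Fin N) → count (λ y → ⌊ x Finₚ.≟ y ⌋) ≤ 1
count-≟ {suc N} zero    = s≤s (≤-reflexive (count-false {N}))
count-≟ {suc N} (suc x) =
  ≤-trans (≤-reflexive (count-cong (λ y → ⌊⌋-map′ _ _ (x Finₚ.≟ y)))) (count-≟ x)

count-separate : ∀ {N} (P Q : Fin N → Bool) → count Q < count P →
  ∃ λ x → P x ≡ true × Q x ≡ false
count-separate {suc N} P Q Q<P with P zero in p | Q zero in q
... | true  | false = zero , p , q
... | true  | true  with x , px , qx ← count-separate (P ∘ suc) (Q ∘ suc) (s≤s⁻¹ Q<P) = suc x , px , qx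
... | false | true  with x , px , qx ← count-separate (P ∘ suc) (Q ∘ suc) (≤-trans (n≤1+n _) Q<P) = suc x , px , qx
... | false | false with x , px , qx ← count-separate (P ∘ suc) (Q ∘ suc) Q<P = suc x , px , qx

count-choose : ∀ {N} (P : Fin N → Bool) n → n ≤ count P →
  Σ (Fin n → Fin N) λ e → Injective _≡_ _≡_ e × (∀ j → P (e j) ≡ true)
count-choose P zero _ = (λ ()) , (λ {}) , (λ ())
count-choose {suc N} P (suc n) n≤P with P zero in p
... | true with e , inj , inP ← count-choose (P ∘ suc) n (s≤s⁻¹ n≤P) =
  lift 1 e , Finₚ.lift-injective e inj 1 , λ { zero → p ; (suc j) → inP j }
... | false with e , inj , inP ← count-choose (P ∘ suc) (suc n) n≤P =
  suc ∘ e , inj ∘ Finₚ.suc-injective , inP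

private
  rank : ∀ {N} (P : Fin N → Bool) x → P x ≡ true → Fin (count P)
  rank {suc N} P zero px with P zero
  ... | true = zero
  rank {suc N} P (suc x) px with P zero
  ... | true  = suc (rank (P ∘ suc) x px)
  ... | false = rank (P ∘ suc) x px

  rank-injective : ∀ {N} (P : Fin N → Bool) x y px py → rank P x px ≡ rank P y py → x ≡ y
  rank-injective {suc N} P zero    zero    px py eq = refl
  rank-injective {suc N} P zero    (suc y) px py eq with P zero
  rank-injective {suc N} P zero    (suc y) px py () | true
  rank-injective {suc N} P (suc x) zero    px py eq with P zero
  rank-injective {suc N} P (suc x) zero    px py () | true
  rank-injective {suc N} P (suc x) (suc y) px py eq with P zero
  ... | true  = cong suc (rank-injective (P ∘ suc) x y px py (Finₚ.suc-injective eq))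
  ... | false = cong suc (rank-injective (P ∘ suc) x y px py eq)

count-injection : ∀ {c N} (P : Fin N → Bool) (e : Fin c → Fin N) → Injective _≡_ _≡_ e →
  (∀ j → P (e j) ≡ true) → c ≤ count P
count-injection P e inj inP = Finₚ.injective⇒≤ {f = λ j → rank P (e j) (inP j)}
  (λ {i} {j} eq → inj (rank-injective P (e i) (e j) (inP i) (inP j) eq))

count-∘-injective : ∀ {M N} (P : Fin N → Bool) (f : Fin M → Fin N) → Injective _≡_ _≡_ f →
  count (P ∘ f) ≤ count P
count-∘-injective P f inj with e , e-inj , inP ← count-choose (P ∘ f) _ ≤-refl =
  count-injection P (f ∘ e) (e-inj ∘ inj) inP

count-union : ∀ {M N} (S : Fin M → Bool) (P : Fin M → Fin N → Bool) b →
  (∀ q → S q ≡ true → count (P q) ≤ b) →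
  count (λ x → anyᶠ (λ q → S q ∧ P q x)) ≤ count S * b
count-union {zero} {N} S P b _ = ≤-reflexive (count-false {N})
count-union {suc M} S P b bound with S zero in s
... | true  = ≤-trans (count-∨ (P zero) _) (+-mono-≤ (bound zero s) rest)
  where rest = count-union (S ∘ suc) (P ∘ suc) b (bound ∘ suc)
... | false = count-union (S ∘ suc) (P ∘ suc) b (bound ∘ suc)

length-filterᵇ-tabulate : ∀ {A : Set} {N} (P : A → Bool) (f : Fin N → A) →
  length (filterᵇ P (tabulate f)) ≡ count (P ∘ f)
length-filterᵇ-tabulate {N = zero}  P f = refl
length-filterᵇ-tabulate {N = suc N} P f with P (f zero)
... | true  = cong suc (length-filterᵇ-tabulate P (f ∘ suc))
... | false = length-filterᵇ-tabulate P (f ∘ suc)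

relabel : ∀ {h h'} → Graph h → (Fin h' → Fin h) → Graph h'
relabel H f = record
  { adj        = λ p q → adj H (f p) (f q)
  ; adj-sym    = λ p q → adj-sym H (f p) (f q)
  ; adj-irrefl = λ p → adj-irrefl H (f p)
  }

⊆G-trans : ∀ {h k N} {H : Graph h} {K : Graph k} {G : Graph N} → H ⊆G K → K ⊆G G → H ⊆G G
⊆G-trans (f , f-inj , f-adj) (g , g-inj , g-adj) =
  g ∘ f , f-inj ∘ g-inj , λ u v uv → g-adj (f u) (f v) (f-adj u v uv)

⊆G-relabel : ∀ {h} (H : Graph h) (σ : Fin h ↔ Fin h) → H ⊆G relabel H (Inverse.to σ)
⊆G-relabel H σ = from , Injection.injective (↔⇒↣ (↔-sym σ)) , λ u v uv →
  subst₂ (λ a b → adj H a b ≡ true) (sym (strictlyInverseˡ u)) (sym (strictlyInverseˡ v)) uv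
  where open Inverse σ

adj-distinct : ∀ {N} (F : Graph N) {x y} → adj F x y ≡ true → x ≢ y
adj-distinct F {x} xy refl with () ← trans (sym xy) (adj-irrefl F x)

⊆G-injection : ∀ {h N} (H : Graph h) (G : Graph N) (f : Fin h → Fin N) → Injective _≡_ _≡_ f →
  (∀ u v → u ≢ v → adj G (f u) (f v) ≡ true) → H ⊆G G
⊆G-injection H G f inj complete = f , inj , λ u v uv → complete u v (adj-distinct H uv)

adj-complement : ∀ {N} (G : Graph N) {x y} → x ≢ y → adj G x y ≡ false → adj (complement G) x y ≡ true
adj-complement G {x} {y} x≢y xy = cong₂ (λ a b → not a ∧ not b) xy (⌊⌋-false (x Finₚ.≟ y) x≢y)

Knn⊆G : ∀ {n N} (F : Graph N) (e e' : Fin n → Fin N) →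
  Injective _≡_ _≡_ e → Injective _≡_ _≡_ e' → (∀ a b → adj F (e a) (e' b) ≡ true) → Knn n ⊆G F
Knn⊆G {n} F e e' e-inj e'-inj cross = f , f-inj , f-adj
  where
  f : Fin (n + n) → _
  f v = [ e , e' ] (splitAt n v)
  f-inj : Injective _≡_ _≡_ f
  f-inj {u} {v} eq with splitAt n u in eu | splitAt n v in ev
  ... | inj₁ a | inj₁ b =
    trans (sym (Finₚ.splitAt⁻¹-↑ˡ eu)) (trans (cong (_↑ˡ n) (e-inj eq)) (Finₚ.splitAt⁻¹-↑ˡ ev))
  ... | inj₂ a | inj₂ b =
    trans (sym (Finₚ.splitAt⁻¹-↑ʳ eu)) (trans (cong (n ↑ʳ_) (e'-inj eq)) (Finₚ.splitAt⁻¹-↑ʳ ev))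
  ... | inj₁ a | inj₂ b = ⊥-elim (adj-distinct F (cross a b) eq)
  ... | inj₂ a | inj₁ b = ⊥-elim (adj-distinct F (cross b a) (sym eq))
  f-adj : ∀ u v → adj (Knn n) u v ≡ true → adj F (f u) (f v) ≡ true
  f-adj u v uv with splitAt n u | splitAt n v
  f-adj u v () | inj₁ a | inj₁ b
  f-adj u v () | inj₂ a | inj₂ b
  ... | inj₁ a | inj₂ b = cross a b
  ... | inj₂ a | inj₁ b = trans (adj-sym F (e' a) (e b)) (cross b a)

-- The n sparse vertices X have closed neighbourhoods of at most s vertices of C
-- each; the n vertices of C outside all of them form the other side.
Knn⊆complement : ∀ {N} (G : Graph N) (C : Fin N → Bool) n s → n * s + n ≤ count C →
  n ≤ count (λ x → ⌊ count (λ y → C y ∧ adj G x y) <? s ⌋) → Knn n ⊆G complement G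
Knn⊆complement {N} G C n s enough-C many-sparse = Knn⊆G (complement G) e e' e-inj e'-inj cross
  where
  X = count-choose _ n many-sparse
  e = proj₁ X
  e-inj = proj₁ (proj₂ X)
  closedNbhd : Fin N → Fin N → Bool
  closedNbhd x y = ⌊ x Finₚ.≟ y ⌋ ∨ (C y ∧ adj G x y)
  closedNbhd≤ : ∀ a → count (closedNbhd (e a)) ≤ s
  closedNbhd≤ a = ≤-trans (count-∨ (λ y → ⌊ e a Finₚ.≟ y ⌋) (λ y → C y ∧ adj G (e a) y))
    (≤-trans (+-monoˡ-≤ _ (count-≟ (e a)))
             (⌊⌋≡true⇒ (count (λ y → C y ∧ adj G (e a) y) <? s) (proj₂ (proj₂ X) a)))
  covered : Fin N → Bool
  covered y = anyᶠ (λ a → closedNbhd (e a) y)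
  covered≤ : count covered ≤ n * s
  covered≤ = subst (λ c → count covered ≤ c * s) (count-true {n})
    (count-union (λ _ → true) (closedNbhd ∘ e) s (λ a _ → closedNbhd≤ a))
  Y : Fin N → Bool
  Y y = C y ∧ not (covered y)
  C⊆Y∪covered : C ⊆ᵇ (λ y → Y y ∨ covered y)
  C⊆Y∪covered y Cy = split (C y) (covered y) Cy
    where
    split : ∀ c d → c ≡ true → (c ∧ not d) ∨ d ≡ true
    split true true  _ = refl
    split true false _ = refl
  enough-Y : n ≤ count Y
  enough-Y = +-cancelˡ-≤ (n * s) n (count Y) (begin
    n * s + n                    ≤⟨ enough-C ⟩
    count C                      ≤⟨ count-mono C⊆Y∪covered ⟩
    count (λ y → Y y ∨ covered y) ≤⟨ count-∨ Y covered ⟩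
    count Y + count covered      ≤⟨ +-monoʳ-≤ (count Y) covered≤ ⟩
    count Y + n * s              ≡⟨ +-comm (count Y) (n * s) ⟩
    n * s + count Y              ∎)
    where open ≤-Reasoning
  X' = count-choose Y n enough-Y
  e' = proj₁ X'
  e'-inj = proj₁ (proj₂ X')
  cross : ∀ a b → adj (complement G) (e a) (e' b) ≡ true
  cross a b = adj-complement G (⌊⌋≡false⇒ (e a Finₚ.≟ e' b) (∨-conicalˡ _ _ not-closed)) not-adj
    where
    in-Y = proj₂ (proj₂ X') b
    not-closed : closedNbhd (e a) (e' b) ≡ false
    not-closed = anyᶠ≡false⇒ _ (not-injective (∧-conicalʳ _ _ in-Y)) a
    not-adj : adj G (e a) (e' b) ≡ false
    not-adj = true∧≡false⇒ (∧-conicalˡ _ _ in-Y) (∨-conicalʳ ⌊ e a Finₚ.≟ e' b ⌋ _ not-closed)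

-- The recursion is what `Knn⊆complement` needs: n·s + n candidates with s = t d.
threshold : ℕ → ℕ → ℕ → ℕ
threshold h n zero    = h
threshold h n (suc d) = n * threshold h n d + n

module _ (h m : ℕ) where
  private
    n = suc m
    t = threshold h n

  threshold-mono : ∀ {d d'} → d ≤ d' → t d ≤ t d'
  threshold-mono {zero}  {zero}   _ = ≤-refl
  threshold-mono {zero}  {suc d'} _ =
    ≤-trans (threshold-mono {zero} {d'} z≤n) (≤-trans (m≤m+n (t d') (m * t d')) (m≤m+n (n * t d') n))
  threshold-mono {suc d} {suc d'} (s≤s d≤d') = +-monoˡ-≤ n (*-monoʳ-≤ n (threshold-mono d≤d'))

  threshold-linear : ∀ d → h + n * d ≤ t d
  threshold-linear zero    = ≤-reflexive (trans (cong (h +_) (*-zeroʳ n)) (+-identityʳ h))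
  threshold-linear (suc d) = begin
    h + n * suc d   ≡⟨ cong (h +_) (trans (*-suc n d) (+-comm n (n * d))) ⟩
    h + (n * d + n) ≡⟨ +-assoc h (n * d) n ⟨
    h + n * d + n   ≤⟨ +-monoˡ-≤ n (threshold-linear d) ⟩
    t d + n         ≤⟨ +-monoˡ-≤ n (m≤m+n (t d) (m * t d)) ⟩
    n * t d + n     ∎
    where open ≤-Reasoning

  threshold>-of-positive : ∀ {u f d} → u < h → f < h → 1 ≤ d → u + f * m < t d
  threshold>-of-positive {u} {f} {d} u<h f<h 1≤d = begin-strict
    u + f * m     <⟨ +-monoˡ-< (f * m) u<h ⟩
    h + f * m     ≤⟨ +-monoʳ-≤ h (*-monoˡ-≤ m (<⇒≤ f<h)) ⟩
    h + h * m     ≡⟨ *-suc h m ⟨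
    h * n         ≡⟨ *-comm h n ⟩
    n * h         ≤⟨ m≤m+n (n * h) n ⟩
    t 1           ≤⟨ threshold-mono 1≤d ⟩
    t d           ∎
    where open ≤-Reasoning

  threshold>-of-≤ : ∀ {u f d} → u < h → f ≤ d → u + f * m < t d
  threshold>-of-≤ {u} {f} {d} u<h f≤d = begin-strict
    u + f * m     <⟨ +-monoˡ-< (f * m) u<h ⟩
    h + f * m     ≤⟨ +-monoʳ-≤ h (*-mono-≤ f≤d (n≤1+n m)) ⟩
    h + d * n     ≡⟨ cong (h +_) (*-comm d n) ⟩
    h + n * d     ≤⟨ threshold-linear d ⟩
    t d           ∎
    where open ≤-Reasoning

threshold≤ : ∀ {h n} r → 2 ≤ h → 2 ≤ n → threshold h n r ≤ h * h * n ^ r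
threshold≤ {h} {n} r 2≤h 2≤n =
  ≤-trans (m≤m+n (threshold h n r) 2) (≤-trans (bound r) (*-monoˡ-≤ (n ^ r) h+2≤h*h))
  where
  open ≤-Reasoning
  h+2≤h*h : h + 2 ≤ h * h
  h+2≤h*h = begin
    h + 2   ≤⟨ +-monoʳ-≤ h 2≤h ⟩
    h + h   ≡⟨ cong (h +_) (+-identityʳ h) ⟨
    2 * h   ≤⟨ *-monoˡ-≤ h 2≤h ⟩
    h * h   ∎
  n+2≤n*2 : n + 2 ≤ n * 2
  n+2≤n*2 = begin
    n + 2       ≤⟨ +-monoʳ-≤ n 2≤n ⟩
    n + n       ≡⟨ cong (n +_) (+-identityʳ n) ⟨
    2 * n       ≡⟨ *-comm 2 n ⟩
    n * 2       ∎
  bound : ∀ d → threshold h n d + 2 ≤ (h + 2) * n ^ d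
  bound zero    = ≤-reflexive (sym (*-identityʳ (h + 2)))
  bound (suc d) = begin
    n * threshold h n d + n + 2   ≡⟨ +-assoc (n * threshold h n d) n 2 ⟩
    n * threshold h n d + (n + 2) ≤⟨ +-monoʳ-≤ (n * threshold h n d) n+2≤n*2 ⟩
    n * threshold h n d + n * 2   ≡⟨ *-distribˡ-+ n (threshold h n d) 2 ⟨
    n * (threshold h n d + 2)     ≤⟨ *-monoʳ-≤ n (bound d) ⟩
    n * ((h + 2) * n ^ d)         ≡⟨ *-assoc n (h + 2) (n ^ d) ⟨
    n * (h + 2) * n ^ d           ≡⟨ cong (_* n ^ d) (*-comm n (h + 2)) ⟩
    (h + 2) * n * n ^ d           ≡⟨ *-assoc (h + 2) n (n ^ d) ⟩
    (h + 2) * (n * n ^ d)         ∎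

-- The strongly degenerate order is the natural order of Fin h (after `relabel`).
module Ordered {h : ℕ} (H : Graph h) where

  earlier : ℕ → Fin h → Bool
  earlier k p = ⌊ toℕ p <? k ⌋

  earlierNbrs : ℕ → Fin h → Fin h → Bool
  earlierNbrs k q p = earlier k p ∧ adj H q p

  earlierDegree : ℕ → Fin h → ℕ
  earlierDegree k q = count (earlierNbrs k q)

  earlierNbrs⁺ : ∀ {k q p} → toℕ p < k → adj H q p ≡ true → earlierNbrs k q p ≡ true
  earlierNbrs⁺ {k} {q} {p} p<k qp = cong₂ _∧_ (⌊⌋-true (toℕ p <? k) p<k) qp

  earlierNbrs⁻ : ∀ {k q p} → earlierNbrs k q p ≡ true → toℕ p < k × adj H q p ≡ true
  earlierNbrs⁻ {k} {q} {p} e = ⌊⌋≡true⇒ (toℕ p <? k) (∧-conicalˡ _ _ e) , ∧-conicalʳ (earlier k p) _ e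

  earlierNbrs-mono : ∀ {k k'} q → k ≤ k' → earlierNbrs k q ⊆ᵇ earlierNbrs k' q
  earlierNbrs-mono q k≤k' p e with p<k , qp ← earlierNbrs⁻ e = earlierNbrs⁺ (≤-trans p<k k≤k') qp

  earlierDegree-mono : ∀ {k k'} q → k ≤ k' → earlierDegree k q ≤ earlierDegree k' q
  earlierDegree-mono q k≤k' = count-mono (earlierNbrs-mono q k≤k')

  earlierDegree-suc : ∀ {q} i → adj H q i ≡ true → suc (earlierDegree (toℕ i) q) ≤ earlierDegree (suc (toℕ i)) q
  earlierDegree-suc {q} i qi = count-insert i (earlierNbrs-mono q (n≤1+n (toℕ i)))
    (cong (_∧ adj H q i) (⌊⌋-false (toℕ i <? toℕ i) (n≮n (toℕ i)))) (earlierNbrs⁺ (n<1+n (toℕ i)) qi)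

  StronglyDegenerateOrder : ℕ → Set
  StronglyDegenerateOrder r = ∀ q → suc (earlierDegree (toℕ q) q) ≤ r ⊎ count (adj H q) ≤ r

  earlierDegree≤r : ∀ {r} → StronglyDegenerateOrder r → ∀ q → earlierDegree (toℕ q) q ≤ r
  earlierDegree≤r degenerate q with degenerate q
  ... | inj₁ d<r   = <⇒≤ d<r
  ... | inj₂ deg≤r = ≤-trans (count-mono {P = earlierNbrs (toℕ q) q} {Q = adj H q}
                                λ p e → ∧-conicalʳ (earlier (toℕ q) p) _ e) deg≤r

module Greedy {h N : ℕ} (H : Graph h) (G : Graph N) (r m : ℕ) where

  open Ordered H

  private
    n = suc m
    t = threshold h n

  candidates : ℕ → (Fin h → Fin N) → Fin h → Fin N → Bool
  candidates k g q x = allᶠ (λ p → not (earlierNbrs k q p) ∨ adj G (g p) x)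

  record PartialEmbedding (k : ℕ) : Set where
    field
      map               : Fin h → Fin N
      map-injective     : ∀ {p p'} → toℕ p < k → toℕ p' < k → map p ≡ map p' → p ≡ p'
      map-adj           : ∀ {p p'} → toℕ p < k → toℕ p' < k →
                          adj H p p' ≡ true → adj G (map p) (map p') ≡ true
      enough-candidates : ∀ q → k ≤ toℕ q → t (r ∸ earlierDegree k q) ≤ count (candidates k map q)

  candidates⁺ : ∀ {k g q x} → (∀ p → toℕ p < k → adj H q p ≡ true → adj G (g p) x ≡ true) →
    candidates k g q x ≡ true
  candidates⁺ all = allᶠ≡true⁺ _ λ p → implicationᵇ⁺ λ e →
    let (p<k , qp) = earlierNbrs⁻ e in all p p<k qp

  candidates⁻ : ∀ {k g q x} → candidates k g q x ≡ true →
    ∀ p → toℕ p < k → adj H q p ≡ true → adj G (g p) x ≡ true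
  candidates⁻ c p p<k qp = implicationᵇ⁻ (allᶠ≡true⇒ _ c p) (earlierNbrs⁺ p<k qp)

  extend : ∀ {i} (P : PartialEmbedding (toℕ i)) x →
    let open PartialEmbedding P in
    (∀ p → toℕ p < toℕ i → map p ≢ x) →
    candidates (toℕ i) map i x ≡ true →
    (∀ q → toℕ i < toℕ q → adj H i q ≡ true →
      t (r ∸ suc (earlierDegree (toℕ i) q)) ≤ count (λ y → candidates (toℕ i) map q y ∧ adj G x y)) →
    PartialEmbedding (suc (toℕ i))
  extend {i} P x fresh x-candidate dense = record
    { map = g' ; map-injective = g'-injective ; map-adj = g'-adj ; enough-candidates = g'-enough }
    where
    open PartialEmbedding P renaming (map to g)
    k = toℕ i
    g' : Fin h → Fin N
    g' = updateAt g i (λ _ → x)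
    g'-new : g' i ≡ x
    g'-new = updateAt-updates i g
    g'-old : ∀ {p} → toℕ p < k → g' p ≡ g p
    g'-old {p} p<k = updateAt-minimal p i g λ { refl → n≮n k p<k }
    new-or-old : ∀ {p} → toℕ p < suc k → p ≡ i ⊎ toℕ p < k
    new-or-old p<1+k with m≤n⇒m<n∨m≡n (s≤s⁻¹ p<1+k)
    ... | inj₁ p<k = inj₂ p<k
    ... | inj₂ p≡k = inj₁ (Finₚ.toℕ-injective p≡k)

    g'-injective : ∀ {p p'} → toℕ p < suc k → toℕ p' < suc k → g' p ≡ g' p' → p ≡ p'
    g'-injective p<1+k p'<1+k eq with new-or-old p<1+k | new-or-old p'<1+k
    ... | inj₁ refl | inj₁ refl = refl
    ... | inj₁ refl | inj₂ p'<k = ⊥-elim (fresh _ p'<k (trans (sym (g'-old p'<k)) (trans (sym eq) g'-new)))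
    ... | inj₂ p<k  | inj₁ refl = ⊥-elim (fresh _ p<k (trans (sym (g'-old p<k)) (trans eq g'-new)))
    ... | inj₂ p<k  | inj₂ p'<k = map-injective p<k p'<k (trans (sym (g'-old p<k)) (trans eq (g'-old p'<k)))

    g'-adj : ∀ {p p'} → toℕ p < suc k → toℕ p' < suc k → adj H p p' ≡ true → adj G (g' p) (g' p') ≡ true
    g'-adj {p} {p'} p<1+k p'<1+k pp' with new-or-old p<1+k | new-or-old p'<1+k
    ... | inj₁ refl | inj₁ refl = ⊥-elim (adj-distinct H pp' refl)
    ... | inj₁ refl | inj₂ p'<k = subst₂ (λ a b → adj G a b ≡ true) (sym g'-new) (sym (g'-old p'<k))
      (trans (adj-sym G x (g p')) (candidates⁻ x-candidate p' p'<k pp'))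
    ... | inj₂ p<k  | inj₁ refl = subst₂ (λ a b → adj G a b ≡ true) (sym (g'-old p<k)) (sym g'-new)
      (candidates⁻ x-candidate p p<k (trans (adj-sym H i p) pp'))
    ... | inj₂ p<k  | inj₂ p'<k = subst₂ (λ a b → adj G a b ≡ true) (sym (g'-old p<k)) (sym (g'-old p'<k))
      (map-adj p<k p'<k pp')

    candidates-extend : ∀ {q y} → candidates k g q y ≡ true → (adj H q i ≡ true → adj G x y ≡ true) →
      candidates (suc k) g' q y ≡ true
    candidates-extend {q} {y} c xy = candidates⁺ λ p p<1+k qp → case new-or-old p<1+k of λ where
      (inj₁ refl) → subst (λ a → adj G a y ≡ true) (sym g'-new) (xy qp)
      (inj₂ p<k)  → subst (λ a → adj G a y ≡ true) (sym (g'-old p<k)) (candidates⁻ c p p<k qp)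

    g'-enough : ∀ q → suc k ≤ toℕ q → t (r ∸ earlierDegree (suc k) q) ≤ count (candidates (suc k) g' q)
    g'-enough q k<q with adj H q i in qi
    ... | false = begin
      t (r ∸ earlierDegree (suc k) q) ≤⟨ threshold-mono h m (∸-monoʳ-≤ r (earlierDegree-mono q (n≤1+n k))) ⟩
      t (r ∸ earlierDegree k q)       ≤⟨ enough-candidates q (<⇒≤ k<q) ⟩
      count (candidates k g q)        ≤⟨ count-mono kept ⟩
      count (candidates (suc k) g' q) ∎
      where
      open ≤-Reasoning
      kept : candidates k g q ⊆ᵇ candidates (suc k) g' q
      kept y c = candidates-extend c λ qi′ → case trans (sym qi′) qi of λ ()
    ... | true = begin
      t (r ∸ earlierDegree (suc k) q)               ≤⟨ threshold-mono h m (∸-monoʳ-≤ r (earlierDegree-suc i qi)) ⟩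
      t (r ∸ suc (earlierDegree k q))               ≤⟨ dense q k<q (trans (adj-sym H i q) qi) ⟩
      count (λ y → candidates k g q y ∧ adj G x y) ≤⟨ count-mono narrowed ⟩
      count (candidates (suc k) g' q)               ∎
      where
      open ≤-Reasoning
      narrowed : (λ y → candidates k g q y ∧ adj G x y) ⊆ᵇ candidates (suc k) g' q
      narrowed y c∧xy = candidates-extend (∧-conicalˡ _ _ c∧xy) λ _ → ∧-conicalʳ _ _ c∧xy

  module Step (degenerate : StronglyDegenerateOrder r) {i : Fin h} (P : PartialEmbedding (toℕ i)) where
    open PartialEmbedding P renaming (map to g)

    private
      k = toℕ i

    later : Fin h → Bool
    later q = ⌊ i Finₚ.<? q ⌋ ∧ adj H i q

    target : Fin h → ℕ
    target q = t (r ∸ suc (earlierDegree k q))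

    sparse : Fin h → Fin N → Bool
    sparse q x = ⌊ count (λ y → candidates k g q y ∧ adj G x y) <? target q ⌋

    later⁻ : ∀ {q} → later q ≡ true → k < toℕ q × adj H i q ≡ true
    later⁻ {q} e = ⌊⌋≡true⇒ (i Finₚ.<? q) (∧-conicalˡ _ _ e) , ∧-conicalʳ ⌊ i Finₚ.<? q ⌋ _ e

    earlierDegree<r : ∀ {q} → later q ≡ true → suc (earlierDegree k q) ≤ r
    earlierDegree<r {q} e with k<q , iq ← later⁻ e = begin
      suc (earlierDegree k q)     ≤⟨ earlierDegree-suc i (trans (adj-sym H q i) iq) ⟩
      earlierDegree (suc k) q     ≤⟨ earlierDegree-mono q k<q ⟩
      earlierDegree (toℕ q) q     ≤⟨ earlierDegree≤r degenerate q ⟩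
      r                           ∎
      where open ≤-Reasoning

    Knn-from-sparse : ∀ q → later q ≡ true → n ≤ count (sparse q) → Knn n ⊆G complement G
    Knn-from-sparse q lq many = Knn⊆complement G (candidates k g q) n (target q) enough many
      where
      enough : n * target q + n ≤ count (candidates k g q)
      enough = subst (λ d → t d ≤ count (candidates k g q)) (∸≡suc∸suc (earlierDegree<r lq))
        (enough-candidates q (<⇒≤ (proj₁ (later⁻ lq))))

    module _ (sparse-small : ∀ q → later q ≡ true → count (sparse q) ≤ m) where

      used : Fin N → Bool
      used x = anyᶠ (λ p → earlier k p ∧ ⌊ g p Finₚ.≟ x ⌋)

      excluded : Fin N → Bool
      excluded x = used x ∨ anyᶠ (λ q → later q ∧ sparse q x)

      excluded<candidates : count excluded < count (candidates k g i)
      excluded<candidates = begin-strict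
        count excluded                        ≤⟨ count-∨ used _ ⟩
        count used + _                        ≤⟨ +-mono-≤ used≤ (count-union later sparse m sparse-small) ⟩
        count (earlier k) + count later * m   <⟨ bound (degenerate i) ⟩
        t (r ∸ earlierDegree k i)             ≤⟨ enough-candidates i ≤-refl ⟩
        count (candidates k g i)              ∎
        where
        open ≤-Reasoning
        used≤ : count used ≤ count (earlier k)
        used≤ = ≤-trans (count-union (earlier k) (λ p x → ⌊ g p Finₚ.≟ x ⌋) 1 (λ p _ → count-≟ (g p)))
                        (≤-reflexive (*-identityʳ _))
        earlier<h : count (earlier k) < h
        earlier<h = count<-missing (earlier k) i (⌊⌋-false (k <? k) (n≮n k))
        later≤ : count later + earlierDegree k i ≤ count (adj H i)
        later≤ = count-disjoint {P = later} {Q = earlierNbrs k i}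
          (λ p lp → cong (_∧ adj H i p) (⌊⌋-false (toℕ p <? k) (<-asym (proj₁ (later⁻ lp)))))
          (λ p lp → proj₂ (later⁻ lp))
          (λ p e → ∧-conicalʳ (earlier k p) _ e)
        bound : suc (earlierDegree k i) ≤ r ⊎ count (adj H i) ≤ r →
          count (earlier k) + count later * m < t (r ∸ earlierDegree k i)
        bound (inj₁ d<r)   = threshold>-of-positive h m earlier<h
          (count<-missing later i (cong (_∧ adj H i i) (⌊⌋-false (i Finₚ.<? i) (n≮n k)))) (m<n⇒0<n∸m d<r)
        bound (inj₂ deg≤r) = threshold>-of-≤ h m earlier<h (m+n≤o⇒m≤o∸n (count later) (≤-trans later≤ deg≤r))

      extension : PartialEmbedding (suc k)
      extension = extend P x fresh x-candidate dense
        where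
        chosen = count-separate (candidates k g i) excluded excluded<candidates
        x = proj₁ chosen
        x-candidate = proj₁ (proj₂ chosen)
        x-unexcluded = proj₂ (proj₂ chosen)
        fresh : ∀ p → toℕ p < k → g p ≢ x
        fresh p p<k = ⌊⌋≡false⇒ (g p Finₚ.≟ x)
          (true∧≡false⇒ (⌊⌋-true (toℕ p <? k) p<k) (anyᶠ≡false⇒ _ (∨-conicalˡ _ _ x-unexcluded) p))
        dense : ∀ q → k < toℕ q → adj H i q ≡ true → target q ≤ count (λ y → candidates k g q y ∧ adj G x y)
        dense q k<q iq = ≮⇒≥ (⌊⌋≡false⇒ (_ <? target q)
          (true∧≡false⇒ (cong₂ _∧_ (⌊⌋-true (i Finₚ.<? q) k<q) iq)
                        (anyᶠ≡false⇒ _ (∨-conicalʳ (used x) _ x-unexcluded) q)))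

    step : PartialEmbedding (suc k) ⊎ Knn n ⊆G complement G
    step with any? (λ q → (later q Boolₚ.≟ true) ×-dec (n ≤? count (sparse q)))
    ... | yes (q , lq , many) = inj₂ (Knn-from-sparse q lq many)
    ... | no none             = inj₁ (extension λ q lq → s≤s⁻¹ (≰⇒> λ many → none (q , lq , many)))

  initial : t r ≤ N → PartialEmbedding 0
  initial t≤N = record
    { map               = g
    ; map-injective     = λ ()
    ; map-adj           = λ ()
    ; enough-candidates = λ q _ → begin
        t (r ∸ earlierDegree 0 q) ≡⟨ cong (λ d → t (r ∸ d)) (no-earlierNbrs q) ⟩
        t r                       ≤⟨ t≤N ⟩
        N                         ≡⟨ all-candidates q ⟨
        count (candidates 0 g q)  ∎
    }
    where
    open ≤-Reasoning
    g : Fin h → Fin N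
    g p = inject≤ p (≤-trans (m≤m+n h (n * r)) (≤-trans (threshold-linear h m r) t≤N))
    no-earlierNbrs : ∀ q → earlierDegree 0 q ≡ 0
    no-earlierNbrs q = trans (count-cong {P = earlierNbrs 0 q} λ p → cong (_∧ adj H q p) (⌊⌋-false (toℕ p <? 0) λ ()))
                             (count-false {h})
    all-candidates : ∀ q → count (candidates 0 g q) ≡ N
    all-candidates q = trans (count-cong λ x → candidates⁺ {0} {g} {q} {x} λ p ()) (count-true {N})

  module _ (degenerate : StronglyDegenerateOrder r) (t≤N : t r ≤ N) where

    step-at : ∀ {k} (i : Fin h) → toℕ i ≡ k →
      PartialEmbedding k → PartialEmbedding (suc k) ⊎ Knn n ⊆G complement G
    step-at i refl P = Step.step degenerate P

    build : ∀ k → k ≤ h → PartialEmbedding k ⊎ Knn n ⊆G complement G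
    build zero    _   = inj₁ (initial t≤N)
    build (suc k) k<h with build k (<⇒≤ k<h)
    ... | inj₁ P = step-at (fromℕ< k<h) (Finₚ.toℕ-fromℕ< k<h) P
    ... | inj₂ K = inj₂ K

    embed-or-Knn : H ⊆G G ⊎ Knn n ⊆G complement G
    embed-or-Knn with build h ≤-refl
    ... | inj₂ K = inj₂ K
    ... | inj₁ P = inj₁ (map , map-injective (Finₚ.toℕ<n _) (Finₚ.toℕ<n _) ,
                         λ p p' → map-adj (Finₚ.toℕ<n p) (Finₚ.toℕ<n p'))
      where open PartialEmbedding P

⊆G-of-≤1 : ∀ {h N} (H : Graph h) (G : Graph N) → h ≤ 1 → h ≤ N → H ⊆G G
⊆G-of-≤1 H G h≤1 h≤N = ⊆G-injection H G (λ p → inject≤ p h≤N) (Finₚ.inject≤-injective h≤N h≤N _ _)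
  λ u v u≢v → ⊥-elim (u≢v (all-equal h≤1 u v))
  where
  all-equal : ∀ {h} → h ≤ 1 → (u v : Fin h) → u ≡ v
  all-equal (s≤s z≤n) zero zero = refl

ramsey-Knn1 : ∀ {h N} (H : Graph h) → h ≤ N → RamseyProp H (Knn 1) N
ramsey-Knn1 H h≤N G with any? (λ u → any? (λ v → ¬? (u Finₚ.≟ v) ×-dec (adj G u v Boolₚ.≟ false)))
... | yes (u , v , u≢v , uv) = inj₂ (Knn⊆G (complement G) (λ _ → u) (λ _ → v) single single
                                     λ _ _ → adj-complement G u≢v uv)
  where
  single : ∀ {x} → Injective _≡_ _≡_ (λ (_ : Fin 1) → x)
  single {_} {zero} {zero} _ = refl
... | no non-edge = inj₁ (⊆G-injection H G f (Finₚ.inject≤-injective h≤N h≤N _ _)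
                         λ u v u≢v → complete (u≢v ∘ Finₚ.inject≤-injective h≤N h≤N u v))
  where
  f : Fin _ → _
  f p = inject≤ p h≤N
  complete : ∀ {x y} → x ≢ y → adj G x y ≡ true
  complete {x} {y} x≢y with adj G x y in xy
  ... | true  = refl
  ... | false = ⊥-elim (non-edge (x , y , x≢y , xy))

module _ {h : ℕ} (H : Graph h) (σ : Fin h ↔ Fin h) where
  open Inverse σ

  -- `backDegree H σ i` is, up to `length-filterᵇ-tabulate`, definitionally the
  -- earlier degree of i in the relabelled graph.
  stronglyDegenerateOrder : ∀ {r} → (∀ i → suc (backDegree H σ i) ≤ r ⊎ degree H (to i) ≤ r) →
    Ordered.StronglyDegenerateOrder (relabel H to) r
  stronglyDegenerateOrder degenerate q with degenerate q
  ... | inj₁ d<r   = inj₁ (subst (λ d → suc d ≤ _) (length-filterᵇ-tabulate earlier-adj id) d<r)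
    where earlier-adj = λ j → ⌊ j Finₚ.<? q ⌋ ∧ adj H (to q) (to j)
  ... | inj₂ deg≤r = inj₂ (begin
    count (adj H (to q) ∘ to) ≤⟨ count-∘-injective (adj H (to q)) to (Injection.injective (↔⇒↣ σ)) ⟩
    count (adj H (to q))      ≡⟨ length-filterᵇ-tabulate (adj H (to q)) id ⟨
    degree H (to q)           ≤⟨ deg≤r ⟩
    _                         ∎)
    where open ≤-Reasoning

h≤h*h*n^r : ∀ h {n} r → n > 0 → h ≤ h * h * n ^ r
h≤h*h*n^r zero        r n>0 = z≤n
h≤h*h*n^r h@(suc _) {n} r n>0 =
  ≤-trans (m≤m*n h (h * n ^ r) {{h*n^r≢0}}) (≤-reflexive (sym (*-assoc h h (n ^ r))))
  where h*n^r≢0 = m*n≢0 h (n ^ r) {{_}} {{m^n≢0 n r {{>-nonZero n>0}}}}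

-- `threshold≤` needs h ≥ 2 and n ≥ 2; smaller h and n = 1 are handled directly.
lemma5p6 : (r h : ℕ) (H : Graph h) → StronglyDegenerate r H →
    (n : ℕ) → n > 0 → RamseyProp H (Knn n) (h * h * n ^ r)
lemma5p6 r zero H _ n n>0 G = inj₁ (⊆G-of-≤1 H G z≤n z≤n)
lemma5p6 r (suc zero) H _ n n>0 G = inj₁ (⊆G-of-≤1 H G ≤-refl (h≤h*h*n^r 1 r n>0))
lemma5p6 r h@(suc (suc _)) H _ (suc zero) n>0 = ramsey-Knn1 H (h≤h*h*n^r h r n>0)
lemma5p6 r h@(suc (suc _)) H (σ , degenerate) n@(suc (suc m)) _ G =
  map₁ (⊆G-trans {H = H} {K = H′} {G = G} (⊆G-relabel H σ))
       (Greedy.embed-or-Knn H′ G r (suc m) (stronglyDegenerateOrder H σ degenerate) t≤N)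
  where
  H′ = relabel H (Inverse.to σ)
  t≤N = threshold≤ r (s≤s (s≤s z≤n)) (s≤s (s≤s z≤n))
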